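{- Let a (function-free, range-restricted) logic program $P$ and a database $D$ be given, where $P$ contains a goal rule with head $\mathit{answer}(X_1,\ldots,X_q)$. For every ground substitution $\theta$ such that $\theta(\mathit{answer}(X_1,\ldots,X_q))$ is a logical consequence of $P\cup D$, the fact $\theta(\mathit{answer}(X_1,\ldots,X_q))$ is computed, i.e. there is a state sequence $S_1,\ldots,S_n$ with $S_1$ the initial state and $\theta(\mathit{answer}(X_1,\ldots,X_q))\in S_n$.
   Context: Setting (function-free Datalog). A rule is a formula $A\leftarrow B_1\wedge\dots\wedge B_n$ with $A,B_i$ atoms $p(t_1,\ldots,t_m)$ whose terms are variables or constants (no function symbols); $A$ is the head, $B_1\wedge\dots\wedge B_n$ the body. A fact is a rule with empty body and no variables. Every rule is range restricted: each variable of the head occurs in the body. Predicates are partitioned into EDB predicates (defined by facts) and IDB predicates (defined by rules). A program is a finite set of rules, each with an IDB predicate in the head and at least one body literal; a database is a finite set of facts with EDB predicates. A distinguished IDB predicate $\mathit{answer}$ does not occur in any rule body; a rule with head predicate $\mathit{answer}$ is a goal rule (the query). Normalization: the variables of a rule, ordered by first occurrence, are renamed to $X_0,X_1,\ldots$ in that order. A state is a set of normalized rules. In every rule with nonempty body the selected literal is the leftmost body literal. Instantiation: if $K\leftarrow L_1\wedge\dots\wedge L_m$ ($m>0$) is a rule in the state and $R$ is a program rule, rename the variables of $R$ apart to get $R'=A'\leftarrow B'_1\wedge\dots\wedge B'_n$; if $L_1$ and $A'$ unify with most general unifier $\sigma$, then $\sigma(R')$ is an instance of $R$. Reduction: if $A\leftarrow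 B_1\wedge\dots\wedge B_n$ is a derived rule and $F$ is a fact (from the database or the state) such that $B_1$ and $F$ unify with mgu $\sigma$, then $\sigma(A\leftarrow B_2\wedge\dots\wedge B_n)$ is a reduct ($F$ reduces the rule). Derived rules are normalized before being added to a state. Initial state: the goal rule together with all rules obtainable from it iteratively by instantiation. Dependency: a rule $R$ depends directly on $R'$ iff the selected literal of $R$ unifies with the head of $R'$; $R$ depends on $R'$ with respect to a state $S$ iff there are $R_1,\ldots,R_n\in S$ with $R_1=R$, each $R_i$ depending directly on $R_{i+1}$, and $R_n$ depending directly on $R'$ ($R'$ need not be in $S$). Successor state: given $P$, $D$, a state $S$ and a fact $F\in D$, the successor $S'$ is built by: (1) initialize $S'$ with all reducts of rules in $S$ by $F$; if this is empty, there is no successor state; (2) if $S'$ contains IDB facts, repeatedly apply reduction to rules in $S$ with facts in $S'$, inserting the results into $S'$, until nothing changes; (3) iteratively apply instantiation to each rule of $S'$ whose selected literal is an IDB literal, adding all instances to $S'$; (4) copy into $S'$ every rule of $S$ that depends (with respect to $S$) on a rule of $S'$ having at least one body literal. A state sequence is $S_1,\ldots,S_n$ where each $S_{i+1}$ is the successor state of $S_i$ for some fact $F_i\in D$. -}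

module Defs where

open import Data.Nat using (ℕ; zero; suc; _≟_)
open import Data.Bool using (Bool; true; false)
open import Data.List using (List; []; _∷_; _++_; concatMap; map; deduplicate)
open import Data.List.Membership.Propositional using (_∈_; _∉_)
open import Data.List.Relation.Unary.All using (All)
open import Data.Product using (Σ; ∃; _×_; _,_)
open import Data.Sum using (_⊎_)
open import Data.Unit using (⊤)
open import Data.Empty using (⊥)
open import Relation.Binary.PropositionalEquality using (_≡_; _≢_)
open import Relation.Nullary using (¬_; yes; no)
open import Function.Definitions using (Injective)

data Term : Set where
  var : ℕ → Term
  con : ℕ → Term

record Atom : Set where
  constructor atom
  field
    pred : ℕ
    args : List Term
open Atom public

record Rule : Set where
  constructor _⇐_
  field
    head : Atom
    body : List Atom
open Rule public

Subst : Set
Subst = ℕ → Term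

substT : Subst → Term → Term
substT σ (var x) = σ x
substT σ (con c) = con c

substA : Subst → Atom → Atom
substA σ (atom p ts) = atom p (map (substT σ) ts)

substR : Subst → Rule → Rule
substR σ (A ⇐ Bs) = substA σ A ⇐ map (substA σ) Bs

renR : (ℕ → ℕ) → Rule → Rule
renR ρ = substR (λ x → var (ρ x))

IsMGU : Subst → Atom → Atom → Set
IsMGU σ A B =
  substA σ A ≡ substA σ B ×
  (∀ (τ : Subst) → substA τ A ≡ substA τ B →
     Σ Subst λ δ → ∀ x → substT δ (σ x) ≡ τ x)

varsT : Term → List ℕ
varsT (var x) = x ∷ []
varsT (con c) = []

varsA : Atom → List ℕ
varsA a = concatMap varsT (args a)

varsR : Rule → List ℕ
varsR r = varsA (head r) ++ concatMap varsA (body r)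

indexOf : ℕ → List ℕ → ℕ
indexOf x [] = zero
indexOf x (y ∷ ys) with x ≟ y
... | yes _ = zero
... | no _ = suc (indexOf x ys)

-- rename the variables, ordered by first occurrence, to X_0, X_1, ...
normalize : Rule → Rule
normalize r = renR (λ x → indexOf x (deduplicate _≟_ (varsR r))) r

HasBody : Rule → Set
HasBody (_ ⇐ []) = ⊥
HasBody (_ ⇐ (_ ∷ _)) = ⊤

IsFactRule : Rule → Set
IsFactRule r = body r ≡ [] × varsA (head r) ≡ []

RangeRestricted : Rule → Set
RangeRestricted r = ∀ x → x ∈ varsA (head r) → x ∈ concatMap varsA (body r)

WFProgram : (ℕ → Bool) → ℕ → List Rule → Set
WFProgram isEDB ans P = ∀ R → R ∈ P →
  HasBody R × isEDB (pred (head R)) ≡ false × RangeRestricted R ×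
  All (λ B → pred B ≢ ans) (body R)

WFDatabase : (ℕ → Bool) → List Atom → Set
WFDatabase isEDB D = ∀ F → F ∈ D → varsA F ≡ [] × isEDB (pred F) ≡ true

record Structure : Set₁ where
  field
    Dom : Set
    cst : ℕ → Dom
    rel : ℕ → List Dom → Set
open Structure public

evalT : (M : Structure) → (ℕ → Dom M) → Term → Dom M
evalT M v (var x) = v x
evalT M v (con c) = cst M c

HoldsA : (M : Structure) → (ℕ → Dom M) → Atom → Set
HoldsA M v a = rel M (pred a) (map (evalT M v) (args a))

SatRule : Structure → Rule → Set
SatRule M R = ∀ v → All (HoldsA M v) (body R) → HoldsA M v (head R)

IsModel : Structure → List Rule → List Atom → Set
IsModel M P D = All (SatRule M) P × All (λ F → ∀ v → HoldsA M v F) D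

Consequence : List Rule → List Atom → Atom → Set₁
Consequence P D A = ∀ (M : Structure) → IsModel M P D → ∀ v → HoldsA M v A

module Datalog (isEDB : ℕ → Bool) (P : List Rule) (D : List Atom) (G : Rule) where

  IsIDB : ℕ → Set
  IsIDB p = isEDB p ≡ false

  Instance : Rule → Rule → Rule → Set
  Instance (K ⇐ []) R I = ⊥
  Instance (K ⇐ (L ∷ Ls)) R I =
    Σ (ℕ → ℕ) λ ρ → Injective _≡_ _≡_ ρ ×
    (∀ x → x ∈ varsR (renR ρ R) → x ∉ varsR (K ⇐ (L ∷ Ls))) ×
    Σ Subst λ σ → IsMGU σ L (head (renR ρ R)) ×
    I ≡ normalize (substR σ (renR ρ R))

  Reduct : Rule → Atom → Rule → Set
  Reduct (A ⇐ []) F X = ⊥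
  Reduct (A ⇐ (B ∷ Bs)) F X =
    Σ Subst λ σ → IsMGU σ B F × X ≡ normalize (substR σ (A ⇐ Bs))

  SelIDB : Rule → Set
  SelIDB (K ⇐ []) = ⊥
  SelIDB (K ⇐ (L ∷ Ls)) = IsIDB (pred L)

  -- direct dependency: selected literal of R unifies with the head of R'
  -- (the two rules renamed apart)
  DirDep : Rule → Rule → Set
  DirDep (K ⇐ []) R' = ⊥
  DirDep (K ⇐ (L ∷ Ls)) R' =
    Σ Subst λ σ → Σ Subst λ τ → substA σ L ≡ substA τ (head R')

  data DependsOn (S : Rule → Set) : Rule → Rule → Set where
    dep-one  : ∀ {R R'} → S R → DirDep R R' → DependsOn S R R'
    dep-step : ∀ {R R₂ R'} → S R → DirDep R R₂ → DependsOn S R₂ R' →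
               DependsOn S R R'

  data Init : Rule → Set where
    init-goal : Init (normalize G)
    init-inst : ∀ {K R I} → Init K → R ∈ P → Instance K R I → Init I

  Step1 : (Rule → Set) → Atom → Rule → Set
  Step1 S F X = Σ Rule λ R → S R × Reduct R F X

  data Step2 (S : Rule → Set) (F : Atom) : Rule → Set where
    s2-base : ∀ {X} → Step1 S F X → Step2 S F X
    s2-red  : ∀ {R H X} → S R → Step2 S F H → IsFactRule H →
              Reduct R (head H) X → Step2 S F X

  data Step3 (S : Rule → Set) (F : Atom) : Rule → Set where
    s3-base : ∀ {X} → Step2 S F X → Step3 S F X
    s3-inst : ∀ {K R I} → Step3 S F K → SelIDB K → R ∈ P →
              Instance K R I → Step3 S F I

  Succ : (Rule → Set) → Atom → Rule → Set
  Succ S F X =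
    Step3 S F X ⊎
    (S X × Σ Rule λ R' → Step3 S F R' × HasBody R' × DependsOn S X R')

  -- a state sequence driven by the facts F₁,…,F_{n-1} from D
  -- (each step requires a successor state to exist, i.e. Step1 nonempty)
  Valid : (Rule → Set) → List Atom → Set
  Valid S [] = ⊤
  Valid S (F ∷ Fs) = F ∈ D × Σ Rule (Step1 S F) × Valid (Succ S F) Fs

  run : (Rule → Set) → List Atom → Rule → Set
  run S [] = S
  run S (F ∷ Fs) = run (Succ S F) Fs

  Computed : Atom → Set
  Computed A = Σ (List Atom) λ Fs → Valid Init Fs × run Init Fs (A ⇐ [])

module Submission where

-- Truth in every model is first replaced by derivability: the structure whose
-- relations are the derivable ground facts is a model of P ∪ D, so every
-- ground consequence has a finite derivation tree whose leaves are database
-- facts.  A derivation of the answer fact is then replayed by a state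
-- sequence.  The replay is described by configurations: a stack of state
-- rules, each with a ground instance whose selected literal is what the rule
-- below yields, the innermost one selecting a database fact F.  The successor
-- state for F reduces that rule (step 1); rules that became facts reduce the
-- next frame (step 2); the first reduct that keeps a body is instantiated
-- along the derivation down to the next database leaf (step 3); the frames
-- above survive by dependency (step 4).  Every successor step consumes one
-- leaf, so the replay ends with the answer fact in a state.

open import Defs
open import Data.Nat using (ℕ; zero; suc; _+_; _∸_; _≤_; _<_; _≤?_; s≤s)
import Data.Nat as ℕ
open import Data.Nat.Properties using (m≤m+n; m≤n+m; ≤-trans; +-cancelʳ-≡; m+n∸n≡m; 1+n≰n; +-assoc; suc-injective)
open import Data.Nat.ListAction using (sum)
open import Data.Bool using (Bool; true; false)
open import Data.List using (List; []; _∷_; map; concatMap; deduplicate)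
open import Data.List.Properties using (∷-injective; map-∘; map-cong)
open import Data.List.Membership.Propositional using (_∈_; _∉_)
open import Data.List.Membership.Propositional.Properties using (∈-++⁺ˡ; ∈-++⁺ʳ; ∈-++⁻; ∈-deduplicate⁺)
open import Data.List.Relation.Binary.Subset.Propositional.Properties using (⊆[]⇒≡[])
open import Data.List.Relation.Unary.Any using (here; there)
open import Data.List.Relation.Unary.All as All using (All; []; _∷_)
open import Data.List.Relation.Unary.All.Properties using (map⁺)
open import Data.List.Relation.Unary.Unique.Propositional using (Unique)
open import Data.Product using (Σ; _×_; _,_; proj₁; proj₂)
open import Data.Sum using (_⊎_; inj₁; inj₂)
open import Data.Unit using (tt)
open import Data.Empty using (⊥-elim)
open import Relation.Binary.PropositionalEquality
open import Relation.Nullary using (yes; no)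
open import Relation.Unary using (_⊆_)
open import Function.Definitions using (Injective)

substTs : Subst → List Term → List Term
substTs σ = map (substT σ)

grounding : (ℕ → ℕ) → Subst
grounding v x = con (v x)

_∘ₛ_ : Subst → Subst → Subst
(δ ∘ₛ σ) x = substT δ (σ x)

_≼_ : Subst → Subst → Set
σ ≼ τ = Σ Subst λ δ → ∀ x → (δ ∘ₛ σ) x ≡ τ x

substT-∘ : ∀ δ σ t → substT δ (substT σ t) ≡ substT (δ ∘ₛ σ) t
substT-∘ δ σ (var x) = refl
substT-∘ δ σ (con c) = refl

substTs-∘ : ∀ δ σ ts → substTs δ (substTs σ ts) ≡ substTs (δ ∘ₛ σ) ts
substTs-∘ δ σ ts = trans (sym (map-∘ ts)) (map-cong (substT-∘ δ σ) ts)

substA-∘ : ∀ δ σ A → substA δ (substA σ A) ≡ substA (δ ∘ₛ σ) A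
substA-∘ δ σ (atom p ts) = cong (atom p) (substTs-∘ δ σ ts)

substR-∘ : ∀ δ σ r → substR δ (substR σ r) ≡ substR (δ ∘ₛ σ) r
substR-∘ δ σ (A ⇐ Bs) =
  cong₂ _⇐_ (substA-∘ δ σ A) (trans (sym (map-∘ Bs)) (map-cong (substA-∘ δ σ) Bs))

module OverLists {X : Set} (vars : X → List ℕ) where

  map-agree : ∀ {Y : Set} {P : ℕ → Set} (f g : X → Y) →
    (∀ a → (∀ x → x ∈ vars a → P x) → f a ≡ g a) →
    ∀ as → (∀ x → x ∈ concatMap vars as → P x) → map f as ≡ map g as
  map-agree f g agree [] _ = refl
  map-agree f g agree (a ∷ as) h =
    cong₂ _∷_ (agree a (λ x m → h x (∈-++⁺ˡ m)))
              (map-agree f g agree as (λ x m → h x (∈-++⁺ʳ (vars a) m)))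

  vars-map⁻ : ∀ (f : X → X) {R : ℕ → ℕ → Set} →
    (∀ a {x} → x ∈ vars (f a) → Σ ℕ λ y → y ∈ vars a × R x y) →
    ∀ as {x} → x ∈ concatMap vars (map f as) → Σ ℕ λ y → y ∈ concatMap vars as × R x y
  vars-map⁻ f item (a ∷ as) m with ∈-++⁻ (vars (f a)) m
  ... | inj₁ m₁ = let y , y∈ , r = item a m₁ in y , ∈-++⁺ˡ y∈ , r
  ... | inj₂ m₂ = let y , y∈ , r = vars-map⁻ f item as m₂ in y , ∈-++⁺ʳ (vars a) y∈ , r

  vars-map⁺ : ∀ (f : X → X) {R : ℕ → ℕ → Set} →
    (∀ a {x y} → y ∈ vars a → R x y → x ∈ vars (f a)) →
    ∀ as {x y} → y ∈ concatMap vars as → R x y → x ∈ concatMap vars (map f as)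
  vars-map⁺ f item (a ∷ as) y∈ r with ∈-++⁻ (vars a) y∈
  ... | inj₁ m₁ = ∈-++⁺ˡ (item a m₁ r)
  ... | inj₂ m₂ = ∈-++⁺ʳ (vars (f a)) (vars-map⁺ f item as m₂ r)

substT-agree : ∀ σ τ t → (∀ x → x ∈ varsT t → σ x ≡ τ x) → substT σ t ≡ substT τ t
substT-agree σ τ (var x) h = h x (here refl)
substT-agree σ τ (con c) h = refl

substA-agree : ∀ σ τ A → (∀ x → x ∈ varsA A → σ x ≡ τ x) → substA σ A ≡ substA τ A
substA-agree σ τ (atom p ts) h =
  cong (atom p) (OverLists.map-agree varsT (substT σ) (substT τ) (substT-agree σ τ) ts h)

substR-agree : ∀ σ τ r → (∀ x → x ∈ varsR r → σ x ≡ τ x) → substR σ r ≡ substR τ r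
substR-agree σ τ (A ⇐ Bs) h =
  cong₂ _⇐_ (proj₁ (∷-injective atoms)) (proj₂ (∷-injective atoms))
  where
    atoms : map (substA σ) (A ∷ Bs) ≡ map (substA τ) (A ∷ Bs)
    atoms = OverLists.map-agree varsA (substA σ) (substA τ) (substA-agree σ τ) (A ∷ Bs) h

substT-cong : ∀ {σ τ} → (∀ x → σ x ≡ τ x) → ∀ t → substT σ t ≡ substT τ t
substT-cong h t = substT-agree _ _ t (λ x _ → h x)

substA-cong : ∀ {σ τ} → (∀ x → σ x ≡ τ x) → ∀ A → substA σ A ≡ substA τ A
substA-cong h A = substA-agree _ _ A (λ x _ → h x)

substR-cong : ∀ {σ τ} → (∀ x → σ x ≡ τ x) → ∀ r → substR σ r ≡ substR τ r
substR-cong h r = substR-agree _ _ r (λ x _ → h x)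

substR-factor : ∀ {σ τ} → (f : σ ≼ τ) → ∀ r → substR (proj₁ f) (substR σ r) ≡ substR τ r
substR-factor {σ} (δ , h) r = trans (substR-∘ δ σ r) (substR-cong h r)

varsT-subst⁻ : ∀ σ t {x} → x ∈ varsT (substT σ t) → Σ ℕ λ y → y ∈ varsT t × x ∈ varsT (σ y)
varsT-subst⁻ σ (var y) m = y , here refl , m

varsT-subst⁺ : ∀ σ t {x y} → y ∈ varsT t → x ∈ varsT (σ y) → x ∈ varsT (substT σ t)
varsT-subst⁺ σ (var y) (here refl) m = m

varsA-subst⁻ : ∀ σ A {x} → x ∈ varsA (substA σ A) → Σ ℕ λ y → y ∈ varsA A × x ∈ varsT (σ y)
varsA-subst⁻ σ (atom p ts) = OverLists.vars-map⁻ varsT (substT σ) (varsT-subst⁻ σ) ts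

varsA-subst⁺ : ∀ σ A {x y} → y ∈ varsA A → x ∈ varsT (σ y) → x ∈ varsA (substA σ A)
varsA-subst⁺ σ (atom p ts) = OverLists.vars-map⁺ varsT (substT σ) (varsT-subst⁺ σ) ts

varsAs-subst⁺ : ∀ σ Bs {x y} → y ∈ concatMap varsA Bs → x ∈ varsT (σ y) →
                x ∈ concatMap varsA (map (substA σ) Bs)
varsAs-subst⁺ σ = OverLists.vars-map⁺ varsA (substA σ) (varsA-subst⁺ σ)

varsR-subst⁻ : ∀ σ r {x} → x ∈ varsR (substR σ r) → Σ ℕ λ y → y ∈ varsR r × x ∈ varsT (σ y)
varsR-subst⁻ σ (A ⇐ Bs) = OverLists.vars-map⁻ varsA (substA σ) (varsA-subst⁻ σ) (A ∷ Bs)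

Ground : Atom → Set
Ground A = varsA A ≡ []

ground-fixed : ∀ σ A → Ground A → substA σ A ≡ A
ground-fixed σ (atom p ts) g = cong (atom p) (fixed ts g)
  where
    fixed : ∀ ts → concatMap varsT ts ≡ [] → substTs σ ts ≡ ts
    fixed [] _ = refl
    fixed (con c ∷ ts) g = cong (con c ∷_) (fixed ts g)
    fixed (var x ∷ ts) ()

constants-ground : ∀ {p} (θ : ℕ → ℕ) xs → Ground (atom p (map (λ x → con (θ x)) xs))
constants-ground θ [] = refl
constants-ground {p} θ (x ∷ xs) = constants-ground {p} θ xs

rr-fact-ground : ∀ A → RangeRestricted (A ⇐ []) → Ground A
rr-fact-ground A rr = ⊆[]⇒≡[] (λ {x} → rr x)

rr-subst : ∀ σ r → RangeRestricted r → RangeRestricted (substR σ r)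
rr-subst σ (A ⇐ Bs) rr x m =
  let y , y∈A , x∈σy = varsA-subst⁻ σ A m in varsAs-subst⁺ σ Bs (rr y y∈A) x∈σy

rr-reduce : ∀ σ A L Bs → RangeRestricted (A ⇐ (L ∷ Bs)) → Ground (substA σ L) →
            RangeRestricted (substA σ A ⇐ map (substA σ) Bs)
rr-reduce σ A L Bs rr g x m with varsA-subst⁻ σ A m
... | y , y∈A , x∈σy with ∈-++⁻ (varsA L) (rr y y∈A)
...   | inj₂ y∈Bs = varsAs-subst⁺ σ Bs y∈Bs x∈σy
...   | inj₁ y∈L with subst (x ∈_) g (varsA-subst⁺ σ L y∈L x∈σy)
...     | ()

bind : ℕ → Term → Subst
bind x t z with z ℕ.≟ x
... | yes _ = t
... | no  _ = var z

bind-self : ∀ x t → bind x t x ≡ t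
bind-self x t with x ℕ.≟ x
... | yes _ = refl
... | no x≢x = ⊥-elim (x≢x refl)

-- In the function-free setting t is a variable or a constant, so bind x t fixes t.
bind-fixes : ∀ x t → substT (bind x t) t ≡ t
bind-fixes x (con c) = refl
bind-fixes x (var y) with y ℕ.≟ x
... | yes _ = refl
... | no  _ = refl

-- Every unifier of x and t factors through bind x t (with itself as factor).
bind-general : ∀ x t τ → τ x ≡ substT τ t → bind x t ≼ τ
bind-general x t τ e = τ , factor
  where
    factor : ∀ z → (τ ∘ₛ bind x t) z ≡ τ z
    factor z with z ℕ.≟ x
    ... | yes refl = sym e
    ... | no  _    = refl

MGUFor : {X : Set} → (Subst → X → X) → Subst → X → X → Set
MGUFor app σ a b = app σ a ≡ app σ b × (∀ τ → app τ a ≡ app τ b → σ ≼ τ)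

mgu-term : ∀ t s τ → substT τ t ≡ substT τ s → Σ Subst λ σ → MGUFor substT σ t s
mgu-term (var x) s _ _ =
  bind x s , trans (bind-self x s) (sym (bind-fixes x s)) , λ τ e → bind-general x s τ e
mgu-term (con c) (var y) _ _ =
  bind y (con c) , sym (bind-self y (con c)) , λ τ e → bind-general y (con c) τ (sym e)
mgu-term (con c) (con .c) _ refl = var , refl , λ τ _ → τ , λ _ → refl

factor-unifies : ∀ {σ τ} → (f : σ ≼ τ) → ∀ t s → substT τ t ≡ substT τ s →
                 substT (proj₁ f) (substT σ t) ≡ substT (proj₁ f) (substT σ s)
factor-unifies {σ} {τ} (δ , h) t s e = begin
  substT δ (substT σ t)  ≡⟨ substT-∘ δ σ t ⟩
  substT (δ ∘ₛ σ) t      ≡⟨ substT-cong h t ⟩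
  substT τ t             ≡⟨ e ⟩
  substT τ s             ≡⟨ sym (substT-cong h s) ⟩
  substT (δ ∘ₛ σ) s      ≡⟨ sym (substT-∘ δ σ s) ⟩
  substT δ (substT σ s)  ∎
  where open ≡-Reasoning

≼-compose : ∀ {σ₁ σ' δ' τ} → (∀ x → (δ' ∘ₛ σ') x ≡ τ x) → σ₁ ≼ δ' → (σ₁ ∘ₛ σ') ≼ τ
≼-compose {σ₁} {σ'} h' (δ , h) =
  δ , λ x → trans (substT-∘ δ σ₁ (σ' x)) (trans (substT-cong h (σ' x)) (h' x))

-- Unifiable argument lists have a most general unifier: unify the tails, then
-- the instances of the heads, and compose.
mgu-terms : ∀ ts ss τ → substTs τ ts ≡ substTs τ ss → Σ Subst λ σ → MGUFor substTs σ ts ss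
mgu-terms [] [] _ _ = var , refl , λ τ _ → τ , λ _ → refl
mgu-terms (t ∷ ts) (s ∷ ss) τ₀ e with ∷-injective e
... | e₁ , e₂ with mgu-terms ts ss τ₀ e₂
... | σ' , unif' , gen'
  with mgu-term (substT σ' t) (substT σ' s) _ (factor-unifies (gen' τ₀ e₂) t s e₁)
... | σ₁ , unif₁ , gen₁ = σ₁ ∘ₛ σ' , cong₂ _∷_ heads tails , general
  where
    heads : substT (σ₁ ∘ₛ σ') t ≡ substT (σ₁ ∘ₛ σ') s
    heads = trans (sym (substT-∘ σ₁ σ' t)) (trans unif₁ (substT-∘ σ₁ σ' s))
    tails : substTs (σ₁ ∘ₛ σ') ts ≡ substTs (σ₁ ∘ₛ σ') ss
    tails = trans (sym (substTs-∘ σ₁ σ' ts)) (trans (cong (substTs σ₁) unif') (substTs-∘ σ₁ σ' ss))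
    general : ∀ τ → substTs τ (t ∷ ts) ≡ substTs τ (s ∷ ss) → (σ₁ ∘ₛ σ') ≼ τ
    general τ e' =
      let e₁' , e₂' = ∷-injective e'
      in ≼-compose {σ₁} {σ'} (proj₂ (gen' τ e₂')) (gen₁ _ (factor-unifies (gen' τ e₂') t s e₁'))

mgu-atom : ∀ A B τ → substA τ A ≡ substA τ B → Σ Subst λ σ → IsMGU σ A B
mgu-atom (atom p ts) (atom q ss) τ e with refl ← cong pred e =
  let σ , unif , gen = mgu-terms ts ss τ (cong args e)
  in σ , cong (atom p) unif , λ τ' e' → gen τ' (cong args e')

-- Normalization is a variable renaming: every instance of r is an instance of
-- normalize r, the renaming being undone by looking the positions up.
-- `nth xs k` is the k-th element of xs (0 past the end).
nth : List ℕ → ℕ → ℕ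
nth [] _ = 0
nth (y ∷ ys) zero = y
nth (y ∷ ys) (suc k) = nth ys k

nth-indexOf : ∀ x xs → x ∈ xs → nth xs (indexOf x xs) ≡ x
nth-indexOf x (y ∷ ys) m with x ℕ.≟ y
... | yes x≡y = sym x≡y
... | no x≢y with m
...   | here x≡y = ⊥-elim (x≢y x≡y)
...   | there m' = nth-indexOf x ys m'

normalize-covers : ∀ r δ → Σ Subst λ η → substR η (normalize r) ≡ substR δ r
normalize-covers r δ = η , trans (substR-∘ η _ r) (substR-agree _ _ r undo)
  where
    vs : List ℕ
    vs = deduplicate ℕ._≟_ (varsR r)
    η : Subst
    η k = δ (nth vs k)
    undo : ∀ x → x ∈ varsR r → η (indexOf x vs) ≡ δ x
    undo x m = cong δ (nth-indexOf x vs (∈-deduplicate⁺ ℕ._≟_ m))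

normalize-covers-factor : ∀ {σ τ} → σ ≼ τ → ∀ r →
  Σ Subst λ η → substR η (normalize (substR σ r)) ≡ substR τ r
normalize-covers-factor {σ} f r =
  let η , e = normalize-covers (substR σ r) (proj₁ f) in η , trans e (substR-factor f r)

normalize-rr : ∀ r → RangeRestricted r → RangeRestricted (normalize r)
normalize-rr r = rr-subst _ r

∈⇒≤sum : ∀ {x xs} → x ∈ xs → x ≤ sum xs
∈⇒≤sum {xs = y ∷ ys} (here refl) = m≤m+n y (sum ys)
∈⇒≤sum {xs = y ∷ ys} (there m) = ≤-trans (∈⇒≤sum m) (m≤n+m (sum ys) y)

-- Renaming rules apart from K: shift their variables above all variables of K.
module RenameApart (K : Rule) where

  -- every variable of K is below m
  m : ℕ
  m = suc (sum (varsR K))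

  shift : ℕ → ℕ
  shift x = x + m

  shift-injective : Injective _≡_ _≡_ shift
  shift-injective {x} {y} = +-cancelʳ-≡ m x y

  shift-apart : ∀ R x → x ∈ varsR (renR shift R) → x ∉ varsR K
  shift-apart R x x∈ x∈K with varsR-subst⁻ (λ z → var (shift z)) R x∈
  ... | y , _ , here refl = 1+n≰n (≤-trans (m≤n+m m y) (∈⇒≤sum x∈K))

splice : ℕ → (ℕ → ℕ) → Subst → Subst
splice m v γ z with m ≤? z
... | yes _ = grounding v (z ∸ m)
... | no  _ = γ z

splice-low : ∀ m v γ z → z < m → splice m v γ z ≡ γ z
splice-low m v γ z z<m with m ≤? z
... | yes m≤z = ⊥-elim (1+n≰n (≤-trans z<m m≤z))
... | no  _   = refl

splice-high : ∀ m v γ y → splice m v γ (y + m) ≡ grounding v y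
splice-high m v γ y with m ≤? (y + m)
... | yes _   = cong (grounding v) (m+n∸n≡m y m)
... | no  m≰y+m = ⊥-elim (m≰y+m (m≤n+m m y))

module Derivations (P : List Rule) (D : List Atom) where

  data Derivable : Atom → Set where
    from-db : ∀ {A} → A ∈ D → Derivable A
    by-rule : ∀ {A} (R : Rule) → R ∈ P → (v : ℕ → ℕ) →
              All Derivable (map (substA (grounding v)) (body R)) →
              substA (grounding v) (head R) ≡ A → Derivable A

  -- The number of database leaves, which the replay consumes one per step.
  leaves : ∀ {A} → Derivable A → ℕ
  leavesAll : ∀ {As} → All Derivable As → ℕ
  leaves (from-db _) = 1
  leaves (by-rule _ _ _ ds _) = leavesAll ds
  leavesAll [] = 0
  leavesAll (d ∷ ds) = leaves d + leavesAll ds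

  derivability : Structure
  derivability = record { Dom = ℕ ; cst = λ c → c ; rel = λ p cs → Derivable (atom p (map con cs)) }

  eval-grounding : ∀ v ts → map con (map (evalT derivability v) ts) ≡ substTs (grounding v) ts
  eval-grounding v ts = trans (sym (map-∘ ts)) (map-cong evalTerm ts)
    where
      evalTerm : ∀ t → con (evalT derivability v t) ≡ substT (grounding v) t
      evalTerm (var x) = refl
      evalTerm (con c) = refl

  holds⇒derivable : ∀ v A → HoldsA derivability v A → Derivable (substA (grounding v) A)
  holds⇒derivable v (atom p ts) = subst (λ us → Derivable (atom p us)) (eval-grounding v ts)

  derivable⇒holds : ∀ v A → Derivable (substA (grounding v) A) → HoldsA derivability v A
  derivable⇒holds v (atom p ts) = subst (λ us → Derivable (atom p us)) (sym (eval-grounding v ts))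

  derivability-model : (∀ F → F ∈ D → Ground F) → IsModel derivability P D
  derivability-model dbGround = All.tabulate satRule , All.tabulate satFact
    where
      satRule : ∀ {R} → R ∈ P → SatRule derivability R
      satRule {R} R∈P v hs = derivable⇒holds v (head R)
        (by-rule R R∈P v (map⁺ (All.map (λ {B} → holds⇒derivable v B) hs)) refl)
      satFact : ∀ {F} → F ∈ D → ∀ v → HoldsA derivability v F
      satFact {F} F∈D v = derivable⇒holds v F
        (subst Derivable (sym (ground-fixed (grounding v) F (dbGround F F∈D))) (from-db F∈D))

  consequence⇒derivable : (∀ F → F ∈ D → Ground F) → ∀ {A} →
    Consequence P D A → Ground A → Derivable A
  consequence⇒derivable dbGround {A} cons g =
    subst Derivable (ground-fixed (grounding v₀) A g)
      (holds⇒derivable v₀ A (cons derivability (derivability-model dbGround) v₀))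
    where
      v₀ : ℕ → ℕ
      v₀ _ = 0

module Replay (isEDB : ℕ → Bool) (ans : ℕ) (P : List Rule) (D : List Atom) (G : Rule)
  (wfP : WFProgram isEDB ans P) (wfD : WFDatabase isEDB D) (target : Atom) where

  open Datalog isEDB P D G
  open Derivations P D

  record ReductOf (A L : Atom) (Bs : List Atom) (F : Atom) (γ : Subst) : Set where
    field
      reduct : Rule
      isReduct : Reduct (A ⇐ (L ∷ Bs)) F reduct
      η : Subst
      covers : substR η reduct ≡ substR γ (A ⇐ Bs)
      rangeRestricted : RangeRestricted reduct

  reduce : ∀ A L Bs γ F → Ground F → substA γ L ≡ F → RangeRestricted (A ⇐ (L ∷ Bs)) →
           ReductOf A L Bs F γ
  reduce A L Bs γ F gF γL≡F rr = record
    { reduct = normalize (substR σ (A ⇐ Bs))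
    ; isReduct = σ , mgu , refl
    ; η = proj₁ cover
    ; covers = proj₂ cover
    ; rangeRestricted = normalize-rr (substR σ (A ⇐ Bs)) (rr-reduce σ A L Bs rr σL-ground)
    }
    where
      unifies : substA γ L ≡ substA γ F
      unifies = trans γL≡F (sym (ground-fixed γ F gF))
      σ : Subst
      σ = proj₁ (mgu-atom L F γ unifies)
      mgu : IsMGU σ L F
      mgu = proj₂ (mgu-atom L F γ unifies)
      cover : Σ Subst λ η → substR η (normalize (substR σ (A ⇐ Bs))) ≡ substR γ (A ⇐ Bs)
      cover = normalize-covers-factor (proj₂ mgu γ unifies) (A ⇐ Bs)
      σL-ground : Ground (substA σ L)
      σL-ground = trans (cong varsA (trans (proj₁ mgu) (ground-fixed σ F gF))) gF

  -- If the head of R has the ground instance γ(L) for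
  -- the selected literal L of K, then R has an instance from K covering that
  -- ground instance of R (R is renamed apart by shifting, and the unifier is
  -- spliced from γ and the grounding).
  record InstanceOf (K R : Rule) (v : ℕ → ℕ) : Set where
    field
      A' L' : Atom
      Bs' : List Atom
      isInstance : Instance K R (A' ⇐ (L' ∷ Bs'))
      η : Subst
      covers : substR η (A' ⇐ (L' ∷ Bs')) ≡ substR (grounding v) R
      rangeRestricted : RangeRestricted (A' ⇐ (L' ∷ Bs'))

  instantiate : ∀ A L Bs γ hR b bs → RangeRestricted (hR ⇐ (b ∷ bs)) → ∀ v →
    substA (grounding v) hR ≡ substA γ L → InstanceOf (A ⇐ (L ∷ Bs)) (hR ⇐ (b ∷ bs)) v
  instantiate A L Bs γ hR b bs rr v e = record
    { A' = head I ; L' = proj₁ (proj₂ parts) ; Bs' = proj₁ (proj₂ (proj₂ parts))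
    ; isInstance = shift , shift-injective , shift-apart R , σ , mgu , refl
    ; η = proj₁ cover
    ; covers = trans (proj₂ cover) shifted-back
    ; rangeRestricted = normalize-rr (substR σ (renR shift R))
                          (rr-subst σ (renR shift R) (rr-subst shiftₛ R rr))
    }
    where
      K R : Rule
      K = A ⇐ (L ∷ Bs)
      R = hR ⇐ (b ∷ bs)
      open RenameApart K
      shiftₛ : Subst
      shiftₛ x = var (shift x)
      τ : Subst
      τ = splice m v γ
      τ∘shift : ∀ x → (τ ∘ₛ shiftₛ) x ≡ grounding v x
      τ∘shift = splice-high m v γ
      τ-on-L : ∀ x → x ∈ varsA L → τ x ≡ γ x
      τ-on-L x x∈L = splice-low m v γ x (s≤s (∈⇒≤sum (∈-++⁺ʳ (varsA A) (∈-++⁺ˡ x∈L))))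
      unifies : substA τ L ≡ substA τ (head (renR shift R))
      unifies = begin
        substA τ L                 ≡⟨ substA-agree τ γ L τ-on-L ⟩
        substA γ L                 ≡⟨ sym e ⟩
        substA (grounding v) hR    ≡⟨ sym (substA-cong τ∘shift hR) ⟩
        substA (τ ∘ₛ shiftₛ) hR    ≡⟨ sym (substA-∘ τ shiftₛ hR) ⟩
        substA τ (substA shiftₛ hR) ∎
        where open ≡-Reasoning
      σ : Subst
      σ = proj₁ (mgu-atom L (head (renR shift R)) τ unifies)
      mgu : IsMGU σ L (head (renR shift R))
      mgu = proj₂ (mgu-atom L (head (renR shift R)) τ unifies)
      I : Rule
      I = normalize (substR σ (renR shift R))
      -- I has a nonempty body because R has one; name its head and body parts.
      parts : Σ Atom λ A' → Σ Atom λ L' → Σ (List Atom) λ Bs' → I ≡ (A' ⇐ (L' ∷ Bs'))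
      parts = _ , _ , _ , refl
      cover : Σ Subst λ η → substR η I ≡ substR τ (renR shift R)
      cover = normalize-covers-factor (proj₂ mgu τ unifies) (renR shift R)
      shifted-back : substR τ (renR shift R) ≡ substR (grounding v) R
      shifted-back = trans (substR-∘ τ shiftₛ R) (substR-cong τ∘shift R)

  db-ground : ∀ F → F ∈ D → Ground F
  db-ground F F∈D = proj₁ (wfD F F∈D)

  db-edb : ∀ F → F ∈ D → isEDB (pred F) ≡ true
  db-edb F F∈D = proj₂ (wfD F F∈D)

  program-hasBody : ∀ R → R ∈ P → HasBody R
  program-hasBody R R∈P = proj₁ (wfP R R∈P)

  program-idb : ∀ R → R ∈ P → isEDB (pred (head R)) ≡ false
  program-idb R R∈P = proj₁ (proj₂ (wfP R R∈P))

  program-rr : ∀ R → R ∈ P → RangeRestricted R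
  program-rr R R∈P = proj₁ (proj₂ (proj₂ (wfP R R∈P)))

  -- The derived instances of the remaining body literals Bs under γ.  The
  -- explicit list of goals lets the instance change without touching the
  -- derivations (and their number of leaves).
  record Remaining (γ : Subst) (Bs : List Atom) : Set where
    constructor remaining
    field
      goals : List Atom
      instantiates : map (substA γ) Bs ≡ goals
      proofs : All Derivable goals

  retarget : ∀ {γ η Bs Bs'} → map (substA η) Bs' ≡ map (substA γ) Bs →
             Remaining γ Bs → Remaining η Bs'
  retarget e (remaining gs inst ds) = remaining gs (trans e inst) ds

  record Frame (S : Rule → Set) (H : Atom) : Set where
    constructor frame
    field
      A L : Atom
      Bs : List Atom
      inState : S (A ⇐ (L ∷ Bs))
      γ : Subst
      selects : substA γ L ≡ H
      rest : Remaining γ Bs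
      rangeRestricted : RangeRestricted (A ⇐ (L ∷ Bs))

    yields : Atom
    yields = substA γ A

    size : ℕ
    size = leavesAll (Remaining.proofs rest)

  open Frame using (yields; size)

  reframe : ∀ {S S' H H'} → S ⊆ S' → H ≡ H' → Frame S H → Frame S' H'
  reframe S⊆S' e (frame A L Bs inS γ sel rest rr) = frame A L Bs (S⊆S' inS) γ (trans sel e) rest rr

  -- A stack of frames of S, the innermost waiting for H, the outermost yielding
  -- the answer fact; k counts the leaves still to be consumed.
  data Stack (S : Rule → Set) : Atom → ℕ → Set where
    done : ∀ {H} → H ≡ target → Stack S H 0
    _▸_  : ∀ {H k} (f : Frame S H) → Stack S (yields f) k → Stack S H (size f + k)

  record Config (S : Rule → Set) (n : ℕ) : Set where
    constructor config
    field
      fact : Atom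
      fromDb : fact ∈ D
      active : Frame S fact
      {k} : ℕ
      stack : Stack S (yields active) k
      measure : n ≡ suc (size active + k)

  InstanceClosed : (Rule → Set) → Set
  InstanceClosed Q = ∀ {K R I} → Q K → SelIDB K → R ∈ P → Instance K R I → Q I

  -- Descending along a derivation of the instance of a selected literal: each
  -- rule step instantiates the corresponding program rule (step 3 of the
  -- successor construction, or the initial state), until a database leaf is
  -- selected.
  descend : ∀ (Q S : Rule → Set) → InstanceClosed Q → Q ⊆ S →
    ∀ {H k} (f : Frame Q H) (d : Derivable H) → Stack S (yields f) k →
    Config S (leaves d + size f + k)
  descend Q S closed Q⊆S f (from-db H∈D) stack =
    config _ H∈D (reframe Q⊆S refl f) stack refl
  descend Q S closed Q⊆S f (by-rule (hR ⇐ []) R∈P v ds eR) stack =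
    ⊥-elim (program-hasBody _ R∈P)
  descend Q S closed Q⊆S {H} {k} f@(frame A L Bs inS γ sel _ _)
          (by-rule (hR ⇐ (b ∷ bs)) R∈P v (d₁ ∷ ds₁) eR) stack =
    subst (Config S) (sym (+-assoc (leaves d₁ + leavesAll ds₁) (size f) k))
      (descend Q S closed Q⊆S f' d₁ (reframe Q⊆S (sym headEq) f ▸ stack))
    where
      idbSelected : SelIDB (A ⇐ (L ∷ Bs))
      idbSelected = trans (cong (λ a → isEDB (pred a)) (trans sel (sym eR)))
                          (program-idb _ R∈P)
      inst : InstanceOf (A ⇐ (L ∷ Bs)) (hR ⇐ (b ∷ bs)) v
      inst = instantiate A L Bs γ hR b bs (program-rr _ R∈P) v (trans eR (sym sel))
      open InstanceOf inst using (A' ; L' ; Bs' ; isInstance ; η ; covers)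
      headEq : substA η A' ≡ H
      headEq = trans (cong head covers) eR
      bodyEq : substA η L' ≡ substA (grounding v) b ×
               map (substA η) Bs' ≡ map (substA (grounding v)) bs
      bodyEq = ∷-injective (cong body covers)
      f' : Frame Q (substA (grounding v) b)
      f' = frame A' L' Bs' (closed inS idbSelected R∈P isInstance) η (proj₁ bodyEq)
                 (remaining _ (proj₂ bodyEq) ds₁) (InstanceOf.rangeRestricted inst)

  -- The stack survives into the successor state by step 4: the rule of each
  -- frame depends directly on the rule T of the frame below (its selected
  -- literal and T's head have a common instance), hence on the rule R' of step
  -- 3 with which the stack was entered.
  lift-stack : ∀ {S F H k} → Stack S H k →
    (T : Rule) (η : Subst) → substA η (head T) ≡ H →
    (R' : Rule) → Step3 S F R' → HasBody R' →
    (∀ K → S K → DirDep K T → DependsOn S K R') → Stack (Succ S F) H k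
  lift-stack (done e) T η eη R' step3 hasBody dependsOnR' = done e
  lift-stack (frame A L Bs inS γ sel rest rr ▸ stack) T η eη R' step3 hasBody dependsOnR' =
    frame A L Bs (inj₂ (inS , R' , step3 , hasBody , dep)) γ sel rest rr
      ▸ lift-stack stack (A ⇐ (L ∷ Bs)) γ refl R' step3 hasBody (λ K SK dd → dep-step SK dd dep)
    where
      dep = dependsOnR' (A ⇐ (L ∷ Bs)) inS (γ , η , trans sel (sym eη))

  Outcome : (Rule → Set) → Atom → ℕ → Set
  Outcome S F n = Succ S F (target ⇐ []) ⊎ Config (Succ S F) n

  -- Ascending after a reduction (step 2): a reduct A ⇐ Bs whose η-instance the
  -- stack waits for either is a (ground) fact, which reduces the rule of the
  -- next frame, or keeps a body, from which we descend again.
  ascend : ∀ {S F} A Bs → Step2 S F (A ⇐ Bs) → (η : Subst) (rest : Remaining η Bs) →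
    RangeRestricted (A ⇐ Bs) → ∀ {H k} → substA η A ≡ H → Stack S H k →
    Outcome S F (leavesAll (Remaining.proofs rest) + k)
  ascend {S} {F} A [] step2 η (remaining _ refl []) rr ηA≡H (done H≡target) =
    inj₁ (inj₁ (s3-base (subst (λ a → Step2 S F (a ⇐ [])) A≡target step2)))
    where
      A≡target : A ≡ target
      A≡target = trans (sym (ground-fixed η A (rr-fact-ground A rr))) (trans ηA≡H H≡target)
  ascend A [] step2 η (remaining _ refl []) rr ηA≡H (frame A₁ L₁ Bs₁ inS γ₁ sel rest₁ rr₁ ▸ stack) =
    ascend (head reduct) (body reduct) (s2-red inS step2 (refl , A-ground) isReduct) η'
      (retarget (cong body covers) rest₁) rangeRestricted (cong head covers) stack
    where
      A-ground = rr-fact-ground A rr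
      A≡γ₁L₁ : substA γ₁ L₁ ≡ A
      A≡γ₁L₁ = trans sel (trans (sym ηA≡H) (ground-fixed η A A-ground))
      open ReductOf (reduce A₁ L₁ Bs₁ γ₁ A A-ground A≡γ₁L₁ rr₁) renaming (η to η')
  ascend {S} {F} A (L ∷ Bs) step2 η (remaining _ refl (d ∷ ds)) rr ηA≡H stack =
    inj₂ (descend (Step3 S F) (Succ S F) (λ q s r i → s3-inst q s r i) inj₁
            (frame A L Bs (s3-base step2) η refl (remaining _ refl ds) rr) d
            (subst (λ h → Stack (Succ S F) h _) (sym ηA≡H)
              (lift-stack stack (A ⇐ (L ∷ Bs)) η ηA≡H (A ⇐ (L ∷ Bs)) (s3-base step2) tt
                (λ K SK dd → dep-one SK dd))))

  Reaches : (Rule → Set) → Atom → Set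
  Reaches S A = Σ (List Atom) λ Fs → Valid S Fs × run S Fs (A ⇐ [])

  -- Every configuration leads to the answer fact: the successor state for the
  -- awaited database fact reduces the active frame (step 1) and ascends, which
  -- consumes one leaf.
  replay : ∀ n {S} → Config S n → Reaches S target
  replay zero (config _ _ _ _ ())
  replay (suc n) {S} (config F F∈D (frame A L Bs inS γ sel rest rr) {k} stack measure) =
    proceed (ascend (head reduct) (body reduct) (s2-base step1) η (retarget (cong body covers) rest)
                    rangeRestricted (cong head covers) stack)
    where
      open ReductOf (reduce A L Bs γ F (db-ground F F∈D) sel rr)
      step1 : Step1 S F reduct
      step1 = _ , inS , isReduct
      proceed : Outcome S F (leavesAll (Remaining.proofs rest) + k) → Reaches S target
      proceed (inj₁ answer) = F ∷ [] , (F∈D , (_ , step1) , tt) , answer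
      proceed (inj₂ next) =
        let Fs , valid , reached = replay n (subst (Config _) (sym (suc-injective measure)) next)
        in F ∷ Fs , (F∈D , (_ , step1) , valid) , reached

  start : ∀ N R v η → Init N → RangeRestricted N → HasBody R →
          substR η N ≡ substR (grounding v) R →
          All Derivable (map (substA (grounding v)) (body R)) →
          substA (grounding v) (head R) ≡ target → Reaches Init target
  start (A ⇐ []) (hR ⇐ (b ∷ bs)) v η _ _ _ e _ _ with () ← cong body e
  start (A ⇐ (L ∷ Bs)) (hR ⇐ (b ∷ bs)) v η initial rr _ e (d₁ ∷ ds₁) eR =
    replay _ (descend Init Init (λ q _ r i → init-inst q r i) (λ i → i)
                (frame A L Bs initial η (proj₁ bodyEq) (remaining _ (proj₂ bodyEq) ds₁) rr)
                d₁ (done (trans (cong head e) eR)))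
    where
      bodyEq : substA η L ≡ substA (grounding v) b ×
               map (substA η) Bs ≡ map (substA (grounding v)) bs
      bodyEq = ∷-injective (cong body e)

  -- A derivation of the answer fact, an IDB atom defined only by the goal rule,
  -- ends with a ground instance of the goal rule, which the normalized goal
  -- rule of the initial state covers; so the answer fact is computed.
  derivation⇒reaches : isEDB (pred target) ≡ false →
    (∀ R → R ∈ P → pred (head R) ≡ pred target → R ≡ G) →
    Derivable target → Reaches Init target
  derivation⇒reaches targetIDB onlyG (from-db t∈D) with () ← trans (sym (db-edb _ t∈D)) targetIDB
  derivation⇒reaches targetIDB onlyG (by-rule R R∈P v ds eR)
    with refl ← onlyG R R∈P (cong pred eR) =
    start (normalize G) G v (proj₁ cover) init-goal (normalize-rr G (program-rr G R∈P))
      (program-hasBody G R∈P) (proj₂ cover) ds eR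
    where
      cover : Σ Subst λ η → substR η (normalize G) ≡ substR (grounding v) G
      cover = normalize-covers G (grounding v)

theorem2 : (isEDB : ℕ → Bool) (ans : ℕ) (P : List Rule) (D : List Atom)
    (G : Rule) (xs : List ℕ) →
    isEDB ans ≡ false → WFProgram isEDB ans P → WFDatabase isEDB D →
    G ∈ P → head G ≡ atom ans (map var xs) → Unique xs →
    (∀ R → R ∈ P → pred (head R) ≡ ans → R ≡ G) →
    (θ : ℕ → ℕ) →
    Consequence P D (atom ans (map (λ x → con (θ x)) xs)) →
    Datalog.Computed isEDB P D G (atom ans (map (λ x → con (θ x)) xs))
theorem2 isEDB ans P D G xs ansIDB wfP wfD _ _ _ onlyG θ cons =
  Replay.derivation⇒reaches isEDB ans P D G wfP wfD answer ansIDB onlyG answerDerivable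
  where
    answer : Atom
    answer = atom ans (map (λ x → con (θ x)) xs)
    answerDerivable : Derivations.Derivable P D answer
    answerDerivable = Derivations.consequence⇒derivable P D (λ F F∈D → proj₁ (wfD F F∈D))
                        cons (constants-ground {ans} θ xs)
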